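{- Let $\mu=(\mu_0,\mu_1,\dotsc,\mu_\ell)$ be an integer partition with $\ell\geq1$, $1\leq d\leq\mu_0$, $\mu_\ell=1$ and $\mu_{\ell-1}\geq d$ (a rigid tile). Then \[ B_{\mu,d}(x,t)=x(1+tx^\ell)^d\qquad\text{and}\qquad \mathbf{F}_{\mu,d}(x,t)=\frac{1}{1-x(1+tx^\ell)^d}. \]
   Context: An anchor word for $\mu$ of length $n$ is a word $a_1\cdots a_n$ over $\{1,\dotsc,d,\infty\}$ such that $a_i\neq\infty$ implies $a_{i+k}\geq a_i+\mu_k$ for $k=1,\dotsc,\ell$ ($\infty$ larger than every integer) and $a_{n-\ell+1}=\cdots=a_n=\infty$. $\mathrm{bigtiles}(w)$ is the number of non-$\infty$ letters, $\mathrm{width}(w)$ the length. A fault-free anchor word is either $(\infty)$ or a word starting with an integer, ending with $\ell$ consecutive $\infty$'s, with that final block the only occurrence of $\ell$ consecutive $\infty$'s. $B_{\mu,d}(x,t)=\sum x^{\mathrm{width}(w)}t^{\mathrm{bigtiles}(w)}$ over fault-free anchor words and $\mathbf{F}_{\mu,d}(x,t)=\sum_{n\geq0}\sum_{w}t^{\mathrm{bigtiles}(w)}x^n$ over all anchor words $w$ of length $n$. -}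

module Defs where

open import Data.Nat using (ℕ; zero; suc; _+_; _∸_; _≤_; _<_)
open import Data.Fin using (Fin; toℕ; fromℕ<)
import Data.Fin as F
open import Data.Maybe using (Maybe; just; nothing)
open import Data.Vec using (Vec; []; _∷_; lookup)
open import Data.Integer as ℤ using (ℤ)
open import Data.Product using (Σ; _×_; ∃)
open import Data.Sum using (_⊎_)
open import Data.Unit using (⊤)
open import Relation.Nullary using (¬_)
open import Relation.Binary.PropositionalEquality using (_≡_)

-- Letters and words
-- A letter over {1,…,d,∞}: `nothing` is ∞, `just a` (a : Fin d) is the
-- integer  toℕ a + 1 ∈ {1,…,d}.

Letter : ℕ → Set
Letter d = Maybe (Fin d)

val : ∀ {d} → Letter d → Maybe ℕ
val nothing  = nothing
val (just a) = just (suc (toℕ a))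

_≥∞_ : Maybe ℕ → ℕ → Set
nothing ≥∞ m = ⊤
just b  ≥∞ m = m ≤ b

-- Words of length n (0-indexed positions: position p is the letter a_{p+1})
Word : ℕ → ℕ → Set
Word d n = Vec (Letter d) n

bigtiles : ∀ {d n} → Word d n → ℕ
bigtiles []             = 0
bigtiles (nothing ∷ w)  = bigtiles w
bigtiles (just _ ∷ w)   = suc (bigtiles w)

-- Anchor words for μ = (μ_0,…,μ_ℓ), μ given as a function Fin (suc ℓ) → ℕ.
-- (1) a_i ≠ ∞ ⇒ a_{i+k} ≥ a_i + μ_k for k = 1,…,ℓ (whenever i+k ≤ n);
-- (2) the last ℓ letters a_{n-ℓ+1},…,a_n are ∞ (all letters if n < ℓ).

IsAnchorWord : ∀ {ℓ} (μ : Fin (suc ℓ) → ℕ) {d n} → Word d n → Set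
IsAnchorWord {ℓ} μ {d} {n} w =
  (∀ (i : Fin n) (k : Fin ℓ) (a : Fin d) → lookup w i ≡ just a →
     (p : toℕ i + suc (toℕ k) < n) →
     val (lookup w (fromℕ< p)) ≥∞ (suc (toℕ a) + μ (F.suc k)))
  × (∀ (i : Fin n) → n ≤ toℕ i + ℓ → lookup w i ≡ nothing)


-- Fault-free anchor words: either the one-letter word (∞), or an anchor word
-- starting with an integer whose final block of ℓ ∞'s is the only
-- occurrence of ℓ consecutive ∞'s.
IsFaultFree : ∀ {ℓ} (μ : Fin (suc ℓ) → ℕ) {d n} → Word d n → Set
IsFaultFree {ℓ} μ {d} {n} w =
  (n ≡ 1 × (∀ (i : Fin n) → lookup w i ≡ nothing))
  ⊎ (IsAnchorWord μ w
     × (Σ (Fin n) λ i → toℕ i ≡ 0 × ∃ λ (a : Fin d) → lookup w i ≡ just a)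
     × (∀ (i : Fin n) → toℕ i + ℓ < n →
          ¬ (∀ (j : Fin n) → toℕ i ≤ toℕ j → toℕ j < toℕ i + ℓ →
               lookup w j ≡ nothing)))

-- Formal power series in x, t with integer coefficients:
-- f n k is the coefficient of x^n t^k.  Equality is coefficientwise.

Series : Set
Series = ℕ → ℕ → ℤ

_≈ˢ_ : Series → Series → Set
f ≈ˢ g = ∀ n k → f n k ≡ g n k

sumTo : ℕ → (ℕ → ℤ) → ℤ
sumTo zero    f = ℤ.0ℤ
sumTo (suc n) f = sumTo n f ℤ.+ f n

1ˢ : Series
1ˢ zero zero = ℤ.1ℤ
1ˢ _    _    = ℤ.0ℤ

X : Series
X 1 zero = ℤ.1ℤ
X _ _    = ℤ.0ℤ

T : Series
T zero 1 = ℤ.1ℤ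
T _ _    = ℤ.0ℤ

_+ˢ_ : Series → Series → Series
(f +ˢ g) n k = f n k ℤ.+ g n k

_-ˢ_ : Series → Series → Series
(f -ˢ g) n k = f n k ℤ.- g n k

_*ˢ_ : Series → Series → Series
(f *ˢ g) n k =
  sumTo (suc n) λ i → sumTo (suc k) λ j → f i j ℤ.* g (n ∸ i) (k ∸ j)

_^ˢ_ : Series → ℕ → Series
f ^ˢ zero  = 1ˢ
f ^ˢ suc m = f *ˢ (f ^ˢ m)

fromℕˢ : (ℕ → ℕ → ℕ) → Series
fromℕˢ c n k = ℤ.+ (c n k)

G : ℕ → ℕ → Series
G ℓ d = X *ˢ ((1ˢ +ˢ (T *ˢ (X ^ˢ ℓ))) ^ˢ d)

-- Cardinality of a subset: the set {w | P w} has exactly m elements,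
-- witnessed by a duplicate-free list listing exactly its elements.
-- (Stated on elements, not on proofs of P, so it is proof-irrelevant.)

open import Data.List using (List; length)
open import Data.List.Relation.Unary.Unique.Propositional using (Unique)
open import Data.List.Membership.Propositional using (_∈_)
open import Function.Bundles using (_⇔_)

HasCount : {A : Set} → (A → Set) → ℕ → Set
HasCount {A} P m =
  Σ (List A) λ ws → Unique ws × (∀ w → w ∈ ws ⇔ P w) × length ws ≡ m

{-# OPTIONS --safe #-}

-- For a rigid tile (μ_k ≥ d for 1 ≤ k < ℓ and μ_ℓ = 1) the anchor condition says exactly that
-- every integer letter b is followed by ℓ - 1 letters ∞ and then by ∞ or an integer > b.
-- So the fault-free words are ∞ and the chains b₁ ∞^(ℓ-1) b₂ ⋯ b_m ∞^(ℓ-1) ∞ with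
-- b₁ < ⋯ < b_m, and a nonempty anchor word is such a chain followed by an anchor word.
-- Count words by their first letter: letting a leading integer be ≥ a instead of ≥ a + 1 adds
-- the words a ∞^(ℓ-1) v, i.e. multiplies the series by 1 + t x^ℓ.  Running a through the d
-- letters gives B = x (1 + t x^ℓ)^d and F = 1 + B F, hence F (1 - B) = 1.

module Submission where

open import Defs
open import Data.Nat using (ℕ; _≤_; _≥_; suc)
open import Data.Fin using (Fin; zero; toℕ; fromℕ) renaming (_≤_ to _≤ᶠ_)
open import Data.Product using (Σ; _×_)
open import Relation.Binary.PropositionalEquality using (_≡_)

open import Data.Bool as Bool using (Bool; true; false; _∧_; _∨_)
open import Data.Bool.Properties using (∧-zeroʳ; T-∧)
open import Data.Fin as Fin using (fromℕ<)
import Data.Fin.Properties as Fin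
import Data.Fin.Relation.Unary.Top as Top
open import Data.Empty using (⊥-elim)
open import Data.Integer using (ℤ; +_; 0ℤ; 1ℤ; _+_; _-_; _*_)
import Data.Integer.Properties as ℤ
open import Algebra.Properties.CommutativeMonoid.Sum ℤ.+-0-commutativeMonoid
  using (sum; sum-cong-≗; sum-replicate-zero; ∑-distrib-+)
open import Algebra.Properties.CommutativeSemigroup ℤ.+-commutativeSemigroup
  using (interchange; x∙yz≈xz∙y)
open import Data.Integer.Solver using (module +-*-Solver)
open import Data.List using (length) renaming ([] to []ᴸ; _∷_ to _∷ᴸ_)
import Data.List.Membership.DecPropositional as DecMembership
open import Data.List.Membership.Propositional using (_∈_)
import Data.List.Relation.Unary.All as All
open import Data.List.Relation.Unary.AllPairs using ([]; _∷_)
open import Data.List.Relation.Unary.Unique.Propositional using (Unique)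
open import Data.Maybe using (just; nothing)
import Data.Maybe.Properties as Maybe
open import Data.Nat as ℕ using (zero; _<_; _∸_; _≡ᵇ_; _≤ᵇ_; _<ᵇ_; z≤n; s≤s; s≤s⁻¹; z<s)
import Data.Nat.Properties as ℕ
open import Data.Nat.GeneralisedArithmetic using (fold)
open import Data.Product using (_,_; proj₁; proj₂; swap)
open import Data.Product.Function.NonDependent.Propositional using (_×-⇔_)
open import Data.Sum using (inj₁; inj₂)
open import Data.Unit using (tt)
open import Data.Vec using ([]; _∷_; lookup)
import Data.Vec.Properties as Vec
open import Function using (_∘_; _⇔_; mk⇔; Equivalence)
import Function.Properties.Equivalence as FunEq
open import Level using (0ℓ)
open import Relation.Binary.Bundles using (Setoid)
open import Relation.Binary.Definitions using (DecidableEquality)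
open import Relation.Binary.PropositionalEquality
  using (_≢_; refl; sym; trans; cong; cong₂; subst; subst₂; module ≡-Reasoning)
import Relation.Binary.Reasoning.Setoid as SetoidReasoning
open import Relation.Nullary using (Dec; yes; no; does; proof; ¬_)
import Relation.Nullary.Reflects as Reflects

open +-*-Solver using (solve; _:+_; _:-_; _:=_)

-- Formal power series

≈ˢ-setoid : Setoid 0ℓ 0ℓ
≈ˢ-setoid = record
  { Carrier       = Series
  ; _≈_           = _≈ˢ_
  ; isEquivalence = record
    { refl  = λ _ _ → refl
    ; sym   = λ f≈g n k → sym (f≈g n k)
    ; trans = λ f≈g g≈h n k → trans (f≈g n k) (g≈h n k)
    }
  }

open Setoid ≈ˢ-setoid using () renaming (refl to ≈ˢ-refl; sym to ≈ˢ-sym; trans to ≈ˢ-trans)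
module ≈ˢ-Reasoning = SetoidReasoning ≈ˢ-setoid

sumTo-cong : ∀ m {f g : ℕ → ℤ} → (∀ {i} → i < m → f i ≡ g i) → sumTo m f ≡ sumTo m g
sumTo-cong zero    f≡g = refl
sumTo-cong (suc m) f≡g = cong₂ _+_ (sumTo-cong m (f≡g ∘ ℕ.m<n⇒m<1+n)) (f≡g (ℕ.n<1+n m))

sumTo-zero : ∀ m {f : ℕ → ℤ} → (∀ i → f i ≡ 0ℤ) → sumTo m f ≡ 0ℤ
sumTo-zero zero    f≡0 = refl
sumTo-zero (suc m) f≡0 = cong₂ _+_ (sumTo-zero m f≡0) (f≡0 m)

sumTo-head : ∀ m (f : ℕ → ℤ) → sumTo (suc m) f ≡ f 0 + sumTo m (f ∘ suc)
sumTo-head zero    f = trans (ℤ.+-identityˡ (f 0)) (sym (ℤ.+-identityʳ (f 0)))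
sumTo-head (suc m) f = trans (cong (_+ f (suc m)) (sumTo-head m f)) (ℤ.+-assoc (f 0) _ _)

sumTo-reverse : ∀ m (f : ℕ → ℤ) → sumTo (suc m) f ≡ sumTo (suc m) (λ i → f (m ∸ i))
sumTo-reverse zero    f = refl
sumTo-reverse (suc m) f = begin
  sumTo (suc m) f + f (suc m)                  ≡⟨ cong (_+ f (suc m)) (sumTo-reverse m f) ⟩
  sumTo (suc m) (λ i → f (m ∸ i)) + f (suc m)  ≡⟨ ℤ.+-comm _ (f (suc m)) ⟩
  f (suc m) + sumTo (suc m) (λ i → f (m ∸ i))  ≡⟨ sumTo-head (suc m) (λ i → f (suc m ∸ i)) ⟨
  sumTo (suc (suc m)) (λ i → f (suc m ∸ i))    ∎
  where open ≡-Reasoning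

sumTo-distrib-+ : ∀ m (f g : ℕ → ℤ) → sumTo m (λ i → f i + g i) ≡ sumTo m f + sumTo m g
sumTo-distrib-+ zero    f g = refl
sumTo-distrib-+ (suc m) f g = trans (cong (_+ (f m + g m)) (sumTo-distrib-+ m f g))
  (interchange (sumTo m f) (sumTo m g) (f m) (g m))

sumTo-distrib-- : ∀ m (f g : ℕ → ℤ) → sumTo m (λ i → f i - g i) ≡ sumTo m f - sumTo m g
sumTo-distrib-- zero    f g = refl
sumTo-distrib-- (suc m) f g = trans (cong (_+ (f m - g m)) (sumTo-distrib-- m f g))
  (solve 4 (λ a b c e → (a :- b) :+ (c :- e) := (a :+ c) :- (b :+ e)) refl
     (sumTo m f) (sumTo m g) (f m) (g m))

infixr 25 x·_ t·_ x^_·_ [1+tx^_]·_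
infixl 22 _·[1+tx^_]^_

x·_ t·_ : Series → Series
(x· f) zero    k = 0ℤ
(x· f) (suc n) k = f n k
(t· f) n zero    = 0ℤ
(t· f) n (suc k) = f n k

x^_·_ : ℕ → Series → Series
x^ zero  · f = f
x^ suc m · f = x· x^ m · f

X≈x·1 : X ≈ˢ x· 1ˢ
X≈x·1 zero          k       = refl
X≈x·1 (suc zero)    zero    = refl
X≈x·1 (suc zero)    (suc k) = refl
X≈x·1 (suc (suc n)) k       = refl

T≈t·1 : T ≈ˢ t· 1ˢ
T≈t·1 zero    zero          = refl
T≈t·1 (suc n) zero          = refl
T≈t·1 zero    (suc zero)    = refl
T≈t·1 zero    (suc (suc k)) = refl
T≈t·1 (suc n) (suc k)       = refl

+ˢ-cong : ∀ {f f′ g g′} → f ≈ˢ f′ → g ≈ˢ g′ → (f +ˢ g) ≈ˢ (f′ +ˢ g′)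
+ˢ-cong f≈ g≈ n k = cong₂ _+_ (f≈ n k) (g≈ n k)

+ˢ-congˡ : ∀ f {g g′} → g ≈ˢ g′ → (f +ˢ g) ≈ˢ (f +ˢ g′)
+ˢ-congˡ f g≈g′ = +ˢ-cong {f = f} {f′ = f} (λ _ _ → refl) g≈g′

-ˢ-congʳ : ∀ {f f′} g → f ≈ˢ f′ → (f -ˢ g) ≈ˢ (f′ -ˢ g)
-ˢ-congʳ g f≈f′ n k = cong (_- g n k) (f≈f′ n k)

*ˢ-congʳ : ∀ {f f′} g → f ≈ˢ f′ → (f *ˢ g) ≈ˢ (f′ *ˢ g)
*ˢ-congʳ g f≈f′ n k =
  sumTo-cong (suc n) λ {i} _ → sumTo-cong (suc k) λ {j} _ → cong (_* g (n ∸ i) (k ∸ j)) (f≈f′ i j)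

x·-cong : ∀ {f g} → f ≈ˢ g → x· f ≈ˢ x· g
x·-cong f≈g zero    k = refl
x·-cong f≈g (suc n) k = f≈g n k

t·-cong : ∀ {f g} → f ≈ˢ g → t· f ≈ˢ t· g
t·-cong f≈g n zero    = refl
t·-cong f≈g n (suc k) = f≈g n k

x^-cong : ∀ m {f g} → f ≈ˢ g → x^ m · f ≈ˢ x^ m · g
x^-cong zero    f≈g = f≈g
x^-cong (suc m) f≈g = x·-cong (x^-cong m f≈g)

t·x·-zero : ∀ f k → (t· x· f) zero k ≡ 0ℤ
t·x·-zero f zero    = refl
t·x·-zero f (suc k) = refl

t·x·-suc : ∀ f n k → (t· x· f) (suc n) k ≡ (t· f) n k
t·x·-suc f n zero    = refl
t·x·-suc f n (suc k) = refl

*ˢ-comm : ∀ f g → (f *ˢ g) ≈ˢ (g *ˢ f)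
*ˢ-comm f g n k = begin
  sumTo (suc n) (λ i → sumTo (suc k) λ j → f i j * g (n ∸ i) (k ∸ j))
    ≡⟨ sumTo-reverse n _ ⟩
  sumTo (suc n) (λ i → sumTo (suc k) λ j → f (n ∸ i) j * g (n ∸ (n ∸ i)) (k ∸ j))
    ≡⟨ sumTo-cong (suc n) (λ _ → sumTo-reverse k _) ⟩
  sumTo (suc n) (λ i → sumTo (suc k) λ j → f (n ∸ i) (k ∸ j) * g (n ∸ (n ∸ i)) (k ∸ (k ∸ j)))
    ≡⟨ sumTo-cong (suc n) (λ {i} i≤n → sumTo-cong (suc k) (λ {j} j≤k → reindex i j i≤n j≤k)) ⟩
  (g *ˢ f) n k ∎
  where
  open ≡-Reasoning
  reindex : ∀ i j → i < suc n → j < suc k →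
         f (n ∸ i) (k ∸ j) * g (n ∸ (n ∸ i)) (k ∸ (k ∸ j)) ≡ g i j * f (n ∸ i) (k ∸ j)
  reindex i j i≤n j≤k = trans
    (cong₂ (λ a b → f (n ∸ i) (k ∸ j) * g a b)
           (ℕ.m∸[m∸n]≡n (s≤s⁻¹ i≤n)) (ℕ.m∸[m∸n]≡n (s≤s⁻¹ j≤k)))
    (ℤ.*-comm (f (n ∸ i) (k ∸ j)) (g i j))

*ˢ-identityˡ : ∀ f → (1ˢ *ˢ f) ≈ˢ f
*ˢ-identityˡ f n k = begin
  (1ˢ *ˢ f) n k
    ≡⟨ sumTo-head n _ ⟩
  sumTo (suc k) (λ j → 1ˢ 0 j * f n (k ∸ j))
    + sumTo n (λ i → sumTo (suc k) λ j → 0ℤ * f (n ∸ suc i) (k ∸ j))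
    ≡⟨ cong₂ _+_ (sumTo-head k _) (sumTo-zero n (λ _ → sumTo-zero (suc k) (λ _ → refl))) ⟩
  (1ℤ * f n k + sumTo k (λ j → 0ℤ * f n (k ∸ suc j))) + 0ℤ
    ≡⟨ ℤ.+-identityʳ _ ⟩
  1ℤ * f n k + sumTo k (λ j → 0ℤ * f n (k ∸ suc j))
    ≡⟨ cong₂ _+_ (ℤ.*-identityˡ (f n k)) (sumTo-zero k (λ _ → refl)) ⟩
  f n k + 0ℤ
    ≡⟨ ℤ.+-identityʳ (f n k) ⟩
  f n k ∎
  where open ≡-Reasoning

*ˢ-distribʳ-+ˢ : ∀ f g h → ((f +ˢ g) *ˢ h) ≈ˢ ((f *ˢ h) +ˢ (g *ˢ h))
*ˢ-distribʳ-+ˢ f g h n k = begin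
  sumTo (suc n) (λ i → sumTo (suc k) λ j → (f i j + g i j) * h (n ∸ i) (k ∸ j))
    ≡⟨ sumTo-cong (suc n) (λ {i} _ → sumTo-cong (suc k) λ {j} _ →
         ℤ.*-distribʳ-+ (h (n ∸ i) (k ∸ j)) (f i j) (g i j)) ⟩
  sumTo (suc n) (λ i → sumTo (suc k) λ j → f i j * h (n ∸ i) (k ∸ j) + g i j * h (n ∸ i) (k ∸ j))
    ≡⟨ sumTo-cong (suc n) (λ _ → sumTo-distrib-+ (suc k) _ _) ⟩
  sumTo (suc n) (λ i → sumTo (suc k) (λ j → f i j * h (n ∸ i) (k ∸ j))
                     + sumTo (suc k) (λ j → g i j * h (n ∸ i) (k ∸ j)))
    ≡⟨ sumTo-distrib-+ (suc n) _ _ ⟩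
  ((f *ˢ h) +ˢ (g *ˢ h)) n k ∎
  where open ≡-Reasoning

*ˢ-distribʳ--ˢ : ∀ f g h → ((f -ˢ g) *ˢ h) ≈ˢ ((f *ˢ h) -ˢ (g *ˢ h))
*ˢ-distribʳ--ˢ f g h n k = begin
  sumTo (suc n) (λ i → sumTo (suc k) λ j → (f i j - g i j) * h (n ∸ i) (k ∸ j))
    ≡⟨ sumTo-cong (suc n) (λ {i} _ → sumTo-cong (suc k) λ {j} _ →
         distrib (f i j) (g i j) (h (n ∸ i) (k ∸ j))) ⟩
  sumTo (suc n) (λ i → sumTo (suc k) λ j → f i j * h (n ∸ i) (k ∸ j) - g i j * h (n ∸ i) (k ∸ j))
    ≡⟨ sumTo-cong (suc n) (λ _ → sumTo-distrib-- (suc k) _ _) ⟩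
  sumTo (suc n) (λ i → sumTo (suc k) (λ j → f i j * h (n ∸ i) (k ∸ j))
                     - sumTo (suc k) (λ j → g i j * h (n ∸ i) (k ∸ j)))
    ≡⟨ sumTo-distrib-- (suc n) _ _ ⟩
  ((f *ˢ h) -ˢ (g *ˢ h)) n k ∎
  where
  open ≡-Reasoning
  open +-*-Solver using (_:*_)
  distrib : ∀ a b c → (a - b) * c ≡ a * c - b * c
  distrib = solve 3 (λ a b c → (a :- b) :* c := a :* c :- b :* c) refl

x·-*ˢ : ∀ f g → ((x· f) *ˢ g) ≈ˢ x· (f *ˢ g)
x·-*ˢ f g zero    k = sumTo-zero 1 (λ _ → sumTo-zero (suc k) (λ _ → refl))
x·-*ˢ f g (suc n) k = begin
  ((x· f) *ˢ g) (suc n) k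
    ≡⟨ sumTo-head (suc n) _ ⟩
  sumTo (suc k) (λ j → 0ℤ * g (suc n) (k ∸ j)) + (f *ˢ g) n k
    ≡⟨ cong (_+ (f *ˢ g) n k) (sumTo-zero (suc k) (λ _ → refl)) ⟩
  0ℤ + (f *ˢ g) n k
    ≡⟨ ℤ.+-identityˡ _ ⟩
  (f *ˢ g) n k ∎
  where open ≡-Reasoning

t·-*ˢ : ∀ f g → ((t· f) *ˢ g) ≈ˢ t· (f *ˢ g)
t·-*ˢ f g n zero    = sumTo-zero (suc n) (λ _ → sumTo-zero 1 (λ _ → refl))
t·-*ˢ f g n (suc k) = sumTo-cong (suc n) λ {i} _ → begin
  sumTo (suc (suc k)) (λ j → (t· f) i j * g (n ∸ i) (suc k ∸ j))
    ≡⟨ sumTo-head (suc k) _ ⟩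
  0ℤ * g (n ∸ i) (suc k) + sumTo (suc k) (λ j → f i j * g (n ∸ i) (k ∸ j))
    ≡⟨ ℤ.+-identityˡ _ ⟩
  sumTo (suc k) (λ j → f i j * g (n ∸ i) (k ∸ j)) ∎
  where open ≡-Reasoning

X-*ˢ : ∀ f → (X *ˢ f) ≈ˢ x· f
X-*ˢ f = begin
  X *ˢ f         ≈⟨ *ˢ-congʳ f X≈x·1 ⟩
  (x· 1ˢ) *ˢ f   ≈⟨ x·-*ˢ 1ˢ f ⟩
  x· (1ˢ *ˢ f)   ≈⟨ x·-cong (*ˢ-identityˡ f) ⟩
  x· f           ∎
  where open ≈ˢ-Reasoning

T-*ˢ : ∀ f → (T *ˢ f) ≈ˢ t· f
T-*ˢ f = begin
  T *ˢ f         ≈⟨ *ˢ-congʳ f T≈t·1 ⟩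
  (t· 1ˢ) *ˢ f   ≈⟨ t·-*ˢ 1ˢ f ⟩
  t· (1ˢ *ˢ f)   ≈⟨ t·-cong (*ˢ-identityˡ f) ⟩
  t· f           ∎
  where open ≈ˢ-Reasoning

X^-*ˢ : ∀ m f → ((X ^ˢ m) *ˢ f) ≈ˢ x^ m · f
X^-*ˢ zero    f = *ˢ-identityˡ f
X^-*ˢ (suc m) f = begin
  (X *ˢ (X ^ˢ m)) *ˢ f   ≈⟨ *ˢ-congʳ f (X-*ˢ (X ^ˢ m)) ⟩
  (x· (X ^ˢ m)) *ˢ f     ≈⟨ x·-*ˢ (X ^ˢ m) f ⟩
  x· ((X ^ˢ m) *ˢ f)     ≈⟨ x·-cong (X^-*ˢ m f) ⟩
  x^ suc m · f           ∎
  where open ≈ˢ-Reasoning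

x^-*ˢ : ∀ m f g → ((x^ m · f) *ˢ g) ≈ˢ x^ m · (f *ˢ g)
x^-*ˢ zero    f g = ≈ˢ-refl
x^-*ˢ (suc m) f g = ≈ˢ-trans (x·-*ˢ (x^ m · f) g) (x·-cong (x^-*ˢ m f g))

f≈1+gf⇒f[1-g]≈1 : ∀ f g → f ≈ˢ (1ˢ +ˢ (g *ˢ f)) → (f *ˢ (1ˢ -ˢ g)) ≈ˢ 1ˢ
f≈1+gf⇒f[1-g]≈1 f g f≈1+gf = begin
  f *ˢ (1ˢ -ˢ g)                     ≈⟨ *ˢ-comm f (1ˢ -ˢ g) ⟩
  (1ˢ -ˢ g) *ˢ f                     ≈⟨ *ˢ-distribʳ--ˢ 1ˢ g f ⟩
  (1ˢ *ˢ f) -ˢ (g *ˢ f)              ≈⟨ -ˢ-congʳ (g *ˢ f) (*ˢ-identityˡ f) ⟩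
  f -ˢ (g *ˢ f)                      ≈⟨ -ˢ-congʳ (g *ˢ f) f≈1+gf ⟩
  (1ˢ +ˢ (g *ˢ f)) -ˢ (g *ˢ f)       ≈⟨ (λ n k → [a+b]-b≡a (1ˢ n k) ((g *ˢ f) n k)) ⟩
  1ˢ                                 ∎
  where
  open ≈ˢ-Reasoning
  [a+b]-b≡a : ∀ a b → (a + b) - b ≡ a
  [a+b]-b≡a = solve 2 (λ a b → (a :+ b) :- b := a) refl

[1+tx^_]·_ : ℕ → Series → Series
[1+tx^ ℓ ]· f = f +ˢ t· x^ ℓ · f

_·[1+tx^_]^_ : Series → ℕ → ℕ → Series
f ·[1+tx^ ℓ ]^ e = fold f [1+tx^ ℓ ]·_ e

[1+tx^]-cong : ∀ ℓ {f g} → f ≈ˢ g → [1+tx^ ℓ ]· f ≈ˢ [1+tx^ ℓ ]· g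
[1+tx^]-cong ℓ f≈g = +ˢ-cong f≈g (t·-cong (x^-cong ℓ f≈g))

[1+tx^]-*ˢ : ∀ ℓ f g → (([1+tx^ ℓ ]· f) *ˢ g) ≈ˢ [1+tx^ ℓ ]· (f *ˢ g)
[1+tx^]-*ˢ ℓ f g = begin
  (f +ˢ t· x^ ℓ · f) *ˢ g              ≈⟨ *ˢ-distribʳ-+ˢ f (t· x^ ℓ · f) g ⟩
  (f *ˢ g) +ˢ ((t· x^ ℓ · f) *ˢ g)     ≈⟨ +ˢ-congˡ (f *ˢ g) (t·-*ˢ (x^ ℓ · f) g) ⟩
  (f *ˢ g) +ˢ t· ((x^ ℓ · f) *ˢ g)     ≈⟨ +ˢ-congˡ (f *ˢ g) (t·-cong (x^-*ˢ ℓ f g)) ⟩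
  (f *ˢ g) +ˢ t· x^ ℓ · (f *ˢ g)       ∎
  where open ≈ˢ-Reasoning

·[1+tx^]^-cong : ∀ ℓ e {f g} → f ≈ˢ g → f ·[1+tx^ ℓ ]^ e ≈ˢ g ·[1+tx^ ℓ ]^ e
·[1+tx^]^-cong ℓ zero    f≈g = f≈g
·[1+tx^]^-cong ℓ (suc e) f≈g = [1+tx^]-cong ℓ (·[1+tx^]^-cong ℓ e f≈g)

·[1+tx^]^-*ˢ : ∀ ℓ e f g → ((f ·[1+tx^ ℓ ]^ e) *ˢ g) ≈ˢ (f *ˢ g) ·[1+tx^ ℓ ]^ e
·[1+tx^]^-*ˢ ℓ zero    f g = ≈ˢ-refl
·[1+tx^]^-*ˢ ℓ (suc e) f g =
  ≈ˢ-trans ([1+tx^]-*ˢ ℓ (f ·[1+tx^ ℓ ]^ e) g) ([1+tx^]-cong ℓ (·[1+tx^]^-*ˢ ℓ e f g))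

1+TX^-*ˢ : ∀ ℓ f → ((1ˢ +ˢ (T *ˢ (X ^ˢ ℓ))) *ˢ f) ≈ˢ [1+tx^ ℓ ]· f
1+TX^-*ˢ ℓ f = begin
  (1ˢ +ˢ (T *ˢ (X ^ˢ ℓ))) *ˢ f         ≈⟨ *ˢ-distribʳ-+ˢ 1ˢ (T *ˢ (X ^ˢ ℓ)) f ⟩
  (1ˢ *ˢ f) +ˢ ((T *ˢ (X ^ˢ ℓ)) *ˢ f)  ≈⟨ +ˢ-cong (*ˢ-identityˡ f) (*ˢ-congʳ f (T-*ˢ (X ^ˢ ℓ))) ⟩
  f +ˢ ((t· (X ^ˢ ℓ)) *ˢ f)            ≈⟨ +ˢ-congˡ f (t·-*ˢ (X ^ˢ ℓ) f) ⟩
  f +ˢ t· ((X ^ˢ ℓ) *ˢ f)              ≈⟨ +ˢ-congˡ f (t·-cong (X^-*ˢ ℓ f)) ⟩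
  [1+tx^ ℓ ]· f                        ∎
  where open ≈ˢ-Reasoning

[1+TX^]^ˢ : ∀ ℓ e → ((1ˢ +ˢ (T *ˢ (X ^ˢ ℓ))) ^ˢ e) ≈ˢ 1ˢ ·[1+tx^ ℓ ]^ e
[1+TX^]^ˢ ℓ zero    = ≈ˢ-refl
[1+TX^]^ˢ ℓ (suc e) =
  ≈ˢ-trans (1+TX^-*ˢ ℓ ((1ˢ +ˢ (T *ˢ (X ^ˢ ℓ))) ^ˢ e)) ([1+tx^]-cong ℓ ([1+TX^]^ˢ ℓ e))

G≈x·[1+tx^]^ : ∀ ℓ d → G ℓ d ≈ˢ x· 1ˢ ·[1+tx^ ℓ ]^ d
G≈x·[1+tx^]^ ℓ d = begin
  X *ˢ (P ^ˢ d)                  ≈⟨ *ˢ-comm X (P ^ˢ d) ⟩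
  (P ^ˢ d) *ˢ X                  ≈⟨ *ˢ-congʳ X ([1+TX^]^ˢ ℓ d) ⟩
  (1ˢ ·[1+tx^ ℓ ]^ d) *ˢ X       ≈⟨ ·[1+tx^]^-*ˢ ℓ d 1ˢ X ⟩
  (1ˢ *ˢ X) ·[1+tx^ ℓ ]^ d       ≈⟨ ·[1+tx^]^-cong ℓ d (≈ˢ-trans (*ˢ-identityˡ X) X≈x·1) ⟩
  x· 1ˢ ·[1+tx^ ℓ ]^ d           ∎
  where
  open ≈ˢ-Reasoning
  P : Series
  P = 1ˢ +ˢ (T *ˢ (X ^ˢ ℓ))

G-*ˢ : ∀ ℓ d f → (G ℓ d *ˢ f) ≈ˢ x· f ·[1+tx^ ℓ ]^ d
G-*ˢ ℓ d f = begin
  G ℓ d *ˢ f                     ≈⟨ *ˢ-congʳ f (G≈x·[1+tx^]^ ℓ d) ⟩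
  (x· 1ˢ ·[1+tx^ ℓ ]^ d) *ˢ f    ≈⟨ ·[1+tx^]^-*ˢ ℓ d (x· 1ˢ) f ⟩
  ((x· 1ˢ) *ˢ f) ·[1+tx^ ℓ ]^ d
    ≈⟨ ·[1+tx^]^-cong ℓ d (≈ˢ-trans (x·-*ˢ 1ˢ f) (x·-cong (*ˢ-identityˡ f))) ⟩
  x· f ·[1+tx^ ℓ ]^ d            ∎
  where open ≈ˢ-Reasoning

-- Counting words

⟦_⟧ : Bool → ℤ
⟦ true  ⟧ = 1ℤ
⟦ false ⟧ = 0ℤ

⟦∨⟧ : ∀ {A B : Set} (a? : Dec A) (b? : Dec B) → ¬ (A × B) →
      ⟦ does a? ∨ does b? ⟧ ≡ ⟦ does a? ⟧ + ⟦ does b? ⟧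
⟦∨⟧ (no _)  b?      _     = sym (ℤ.+-identityˡ ⟦ does b? ⟧)
⟦∨⟧ (yes _) (no _)  _     = refl
⟦∨⟧ (yes a) (yes b) ¬a×b  = ⊥-elim (¬a×b (a , b))

sum-zero : ∀ {m} (f : Fin m → ℤ) → (∀ b → f b ≡ 0ℤ) → sum f ≡ 0ℤ
sum-zero {m} f f≡0 = trans (sum-cong-≗ f≡0) (sum-replicate-zero m)

<ᵇ-suc : ∀ a t → (a <ᵇ suc t) ≡ (a ≤ᵇ t)
<ᵇ-suc zero    t = refl
<ᵇ-suc (suc a) t = refl

sum-threshold-peel : ∀ {m} a (a<m : a < m) (F : Bool → Fin m → ℤ) → (∀ b → F false b ≡ 0ℤ) →
           sum (λ b → F (a ≤ᵇ toℕ b) b) ≡ F true (fromℕ< a<m) + sum (λ b → F (suc a ≤ᵇ toℕ b) b)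
sum-threshold-peel {suc m} zero    _   F F-false = cong (λ s → F true Fin.zero + s)
  (sym (trans (cong (_+ rest) (F-false Fin.zero)) (ℤ.+-identityˡ rest)))
  where
  rest : ℤ
  rest = sum (λ b → F true (Fin.suc b))
sum-threshold-peel {suc m} (suc a) a<m F F-false = begin
  F false Fin.zero + sum (λ b → F (a <ᵇ suc (toℕ b)) (Fin.suc b))
    ≡⟨ cong₂ _+_ (F-false Fin.zero)
                 (sum-cong-≗ λ b → cong (λ β → F β (Fin.suc b)) (<ᵇ-suc a (toℕ b))) ⟩
  0ℤ + sum (λ b → F (a ≤ᵇ toℕ b) (Fin.suc b))
    ≡⟨ ℤ.+-identityˡ _ ⟩
  sum (λ b → F (a ≤ᵇ toℕ b) (Fin.suc b))
    ≡⟨ sum-threshold-peel a (ℕ.s<s⁻¹ a<m) (λ β b → F β (Fin.suc b)) (F-false ∘ Fin.suc) ⟩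
  F true (fromℕ< a<m) + sum (λ b → F (suc a ≤ᵇ toℕ b) (Fin.suc b))
    ≡⟨ cong (λ s → F true (fromℕ< a<m) + s)
            (trans (cong (_+ rest) (F-false Fin.zero)) (ℤ.+-identityˡ rest)) ⟨
  F true (fromℕ< a<m) + (F false Fin.zero + rest) ∎
  where
  open ≡-Reasoning
  rest : ℤ
  rest = sum (λ b → F (suc a ≤ᵇ toℕ b) (Fin.suc b))

sum-δ : ∀ {m} (b : Fin m) → sum (λ c → ⟦ does (c Fin.≟ b) ⟧) ≡ 1ℤ
sum-δ {suc m} Fin.zero = cong (λ s → 1ℤ + s) (sum-zero {m} _ λ _ → refl)
sum-δ {suc m} (Fin.suc b) = trans (ℤ.+-identityˡ _) (sum-δ b)

module _ {d : ℕ} where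

  ∑ᴸ : (Letter d → ℤ) → ℤ
  ∑ᴸ f = f nothing + sum (f ∘ just)

  ∑ʷ : ∀ n → (Word d n → ℤ) → ℤ
  ∑ʷ zero    f = f []
  ∑ʷ (suc n) f = ∑ᴸ λ x → ∑ʷ n λ w → f (x ∷ w)

  ∑ᴸ-cong : ∀ {f g : Letter d → ℤ} → (∀ x → f x ≡ g x) → ∑ᴸ f ≡ ∑ᴸ g
  ∑ᴸ-cong f≡g = cong₂ _+_ (f≡g nothing) (sum-cong-≗ (f≡g ∘ just))

  ∑ʷ-cong : ∀ n {f g : Word d n → ℤ} → (∀ w → f w ≡ g w) → ∑ʷ n f ≡ ∑ʷ n g
  ∑ʷ-cong zero    f≡g = f≡g []
  ∑ʷ-cong (suc n) f≡g = ∑ᴸ-cong λ x → ∑ʷ-cong n λ w → f≡g (x ∷ w)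

  ∑ʷ-zero : ∀ n {f : Word d n → ℤ} → (∀ w → f w ≡ 0ℤ) → ∑ʷ n f ≡ 0ℤ
  ∑ʷ-zero zero    f≡0 = f≡0 []
  ∑ʷ-zero (suc n) f≡0 =
    cong₂ _+_ (∑ʷ-zero n (f≡0 ∘ (nothing ∷_))) (sum-zero _ λ c → ∑ʷ-zero n (f≡0 ∘ (just c ∷_)))

  ∑ʷ-distrib-+ : ∀ n (f g : Word d n → ℤ) → ∑ʷ n (λ w → f w + g w) ≡ ∑ʷ n f + ∑ʷ n g
  ∑ʷ-distrib-+ zero    f g = refl
  ∑ʷ-distrib-+ (suc n) f g = trans
    (∑ᴸ-cong λ x → ∑ʷ-distrib-+ n (f ∘ (x ∷_)) (g ∘ (x ∷_)))
    (∑ᴸ-distrib-+ (λ x → ∑ʷ n (f ∘ (x ∷_))) (λ x → ∑ʷ n (g ∘ (x ∷_))))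
    where
    ∑ᴸ-distrib-+ : ∀ (f g : Letter d → ℤ) → ∑ᴸ (λ x → f x + g x) ≡ ∑ᴸ f + ∑ᴸ g
    ∑ᴸ-distrib-+ f g = trans (cong (λ s → f nothing + g nothing + s) (∑-distrib-+ (f ∘ just) (g ∘ just)))
      (interchange (f nothing) (g nothing) (sum (f ∘ just)) (sum (g ∘ just)))

  _≟ˡ_ : DecidableEquality (Letter d)
  _≟ˡ_ = Maybe.≡-dec Fin._≟_

  _≟ʷ_ : ∀ {n} → DecidableEquality (Word d n)
  _≟ʷ_ = Vec.≡-dec _≟ˡ_

  ∑ᴸ-δ : ∀ y → ∑ᴸ (λ x → ⟦ does (x ≟ˡ y) ⟧) ≡ 1ℤ
  ∑ᴸ-δ nothing  = cong (λ s → 1ℤ + s) (sum-zero {d} _ λ _ → refl)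
  ∑ᴸ-δ (just b) = trans (ℤ.+-identityˡ _) (sum-δ b)

  ∑ʷ-δ : ∀ {n} (v : Word d n) → ∑ʷ n (λ w → ⟦ does (w ≟ʷ v) ⟧) ≡ 1ℤ
  ∑ʷ-δ []               = refl
  ∑ʷ-δ {suc n} (y ∷ v) = trans (∑ᴸ-cong λ x → restrict (does (x ≟ˡ y))) (∑ᴸ-δ y)
    where
    restrict : ∀ β → ∑ʷ n (λ w → ⟦ β ∧ does (w ≟ʷ v) ⟧) ≡ ⟦ β ⟧
    restrict true  = ∑ʷ-δ v
    restrict false = ∑ʷ-zero n λ _ → refl

  module _ {n : ℕ} where
    open DecMembership (_≟ʷ_ {n}) using (_∈?_)

    ∑ʷ-∈ : ∀ {ws} → Unique ws → ∑ʷ n (λ w → ⟦ does (w ∈? ws) ⟧) ≡ + length ws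
    ∑ʷ-∈ {[]ᴸ}      []           = ∑ʷ-zero n λ _ → refl
    ∑ʷ-∈ {v ∷ᴸ ws} (v∉ws ∷ uniq) = begin
      ∑ʷ n (λ w → ⟦ does (w ≟ʷ v) ∨ does (w ∈? ws) ⟧)
        ≡⟨ ∑ʷ-cong n (λ w → ⟦∨⟧ (w ≟ʷ v) (w ∈? ws) λ (w≡v , w∈ws) → notBoth w≡v w∈ws) ⟩
      ∑ʷ n (λ w → ⟦ does (w ≟ʷ v) ⟧ + ⟦ does (w ∈? ws) ⟧)
        ≡⟨ ∑ʷ-distrib-+ n _ _ ⟩
      ∑ʷ n (λ w → ⟦ does (w ≟ʷ v) ⟧) + ∑ʷ n (λ w → ⟦ does (w ∈? ws) ⟧)
        ≡⟨ cong₂ _+_ (∑ʷ-δ v) (∑ʷ-∈ uniq) ⟩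
      1ℤ + + length ws ∎
      where
      open ≡-Reasoning
      notBoth : ∀ {w} → w ≡ v → ¬ w ∈ ws
      notBoth refl v∈ws = All.lookup v∉ws v∈ws refl

    HasCount⇒∑ʷ : ∀ {P : Word d n → Set} {m} (p : Word d n → Bool) →
                  (∀ w → P w ⇔ Bool.T (p w)) → HasCount P m → + m ≡ ∑ʷ n (λ w → ⟦ p w ⟧)
    HasCount⇒∑ʷ p P⇔p (ws , uniq , ∈⇔P , refl) = trans (sym (∑ʷ-∈ uniq)) (∑ʷ-cong n same)
      where
      same : ∀ w → ⟦ does (w ∈? ws) ⟧ ≡ ⟦ p w ⟧
      same w = cong ⟦_⟧ (Reflects.det (proof (w ∈? ws)) (Reflects.fromEquivalence
        (Equivalence.from (∈⇔P w) ∘ Equivalence.from (P⇔p w))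
        (Equivalence.to (P⇔p w) ∘ Equivalence.to (∈⇔P w))))

  WordPred : Set
  WordPred = ∀ {n} → Word d n → Bool

  count : WordPred → Series
  count P n k = ∑ʷ n λ w → ⟦ P w ∧ (bigtiles w ≡ᵇ k) ⟧

  count-cong : ∀ {P Q : WordPred} → (∀ {n} (w : Word d n) → P w ≡ Q w) → count P ≈ˢ count Q
  count-cong P≡Q n k = ∑ʷ-cong n λ w → cong (λ β → ⟦ β ∧ (bigtiles w ≡ᵇ k) ⟧) (P≡Q w)

  count-∷-cong : ∀ (P Q : WordPred) → (∀ x {n} (w : Word d n) → P (x ∷ w) ≡ Q (x ∷ w)) →
                 ∀ n k → count P (suc n) k ≡ count Q (suc n) k
  count-∷-cong P Q P≡Q n k =
    ∑ʷ-cong (suc n) {λ w → ⟦ P w ∧ (bigtiles w ≡ᵇ k) ⟧} {λ w → ⟦ Q w ∧ (bigtiles w ≡ᵇ k) ⟧}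
      λ { (x ∷ w) → cong (λ β → ⟦ β ∧ (bigtiles (x ∷ w) ≡ᵇ k) ⟧) (P≡Q x w) }

  count-∅ : ∀ n k → count (λ _ → false) n k ≡ 0ℤ
  count-∅ n k = ∑ʷ-zero n λ _ → refl

  t·count-∅ : ∀ n k → (t· count (λ _ → false)) n k ≡ 0ℤ
  t·count-∅ n zero    = refl
  t·count-∅ n (suc k) = count-∅ n k

  count-∷ : ∀ (P : WordPred) n k → count P (suc n) k ≡
    count (λ w → P (nothing ∷ w)) n k + sum (λ b → (t· count (λ w → P (just b ∷ w))) n k)
  count-∷ P n zero    = cong (λ s → count (λ w → P (nothing ∷ w)) n zero + s)
    (sum-cong-≗ λ b → ∑ʷ-zero n λ w → cong ⟦_⟧ (∧-zeroʳ (P (just b ∷ w))))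
  count-∷ P n (suc k) = refl

  HasCount⇒count : ∀ {P : ∀ {n} → Word d n → Set} (p : WordPred) →
                   (∀ {n} (w : Word d n) → P w ⇔ Bool.T (p w)) →
                   ∀ {n k m} → HasCount (λ (w : Word d n) → P w × bigtiles w ≡ k) m → + m ≡ count p n k
  HasCount⇒count p P⇔p {n} {k} = HasCount⇒∑ʷ (λ w → p w ∧ (bigtiles w ≡ᵇ k)) λ w → FunEq.trans
    (P⇔p w ×-⇔ mk⇔ (ℕ.≡⇒≡ᵇ (bigtiles w) k) (ℕ.≡ᵇ⇒≡ (bigtiles w) k)) (FunEq.sym T-∧)

  blanksThen : ℕ → WordPred → WordPred
  blanksThen zero    P w             = P w
  blanksThen (suc r) P []            = false
  blanksThen (suc r) P (nothing ∷ w) = blanksThen r P w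
  blanksThen (suc r) P (just _ ∷ w)  = false

  count-blanksThen : ∀ r (P : WordPred) → count (blanksThen r P) ≈ˢ x^ r · count P
  count-blanksThen zero    P n       k = refl
  count-blanksThen (suc r) P zero    k = refl
  count-blanksThen (suc r) P (suc n) k = begin
    count (blanksThen (suc r) P) (suc n) k
      ≡⟨ count-∷ (blanksThen (suc r) P) n k ⟩
    count (blanksThen r P) n k + sum (λ (_ : Fin d) → (t· count (λ _ → false)) n k)
      ≡⟨ cong (λ s → count (blanksThen r P) n k + s)
              (sum-zero {d} (λ _ → (t· count (λ _ → false)) n k) λ _ → t·count-∅ n k) ⟩
    count (blanksThen r P) n k + 0ℤ
      ≡⟨ ℤ.+-identityʳ _ ⟩
    count (blanksThen r P) n k
      ≡⟨ count-blanksThen r P n k ⟩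
    (x^ r · count P) n k ∎
    where open ≡-Reasoning

module FirstLetter {d : ℕ} (ℓ′ : ℕ) (E : WordPred {d}) (Q : ℕ → WordPred {d})
  (Q-[]  : ∀ a → Q a [] ≡ false)
  (Q-∞∷ : ∀ a {n} (w : Word d n) → Q a (nothing ∷ w) ≡ E w)
  (Q-b∷ : ∀ a b {n} (w : Word d n) →
           Q a (just b ∷ w) ≡ ((a ≤ᵇ toℕ b) ∧ blanksThen ℓ′ (Q (suc (toℕ b))) w))
  where

  private
    afterTile : Bool → Fin d → ℕ → ℕ → ℤ
    afterTile β b = t· count (λ w → β ∧ blanksThen ℓ′ (Q (suc (toℕ b))) w)

  count-Q-zero : ∀ a k → count (Q a) zero k ≡ 0ℤ
  count-Q-zero a k = cong (λ β → ⟦ β ∧ (0 ≡ᵇ k) ⟧) (Q-[] a)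

  count-Q-suc : ∀ a n k → count (Q a) (suc n) k ≡ count E n k + sum (λ b → afterTile (a ≤ᵇ toℕ b) b n k)
  count-Q-suc a n k = trans (count-∷ (Q a) n k)
    (cong₂ _+_ (count-cong (Q-∞∷ a) n k) (sum-cong-≗ λ b → t·-cong (count-cong (Q-b∷ a b)) n k))

  count-Q-step : ∀ a → a < d → count (Q a) ≈ˢ [1+tx^ suc ℓ′ ]· count (Q (suc a))
  count-Q-step a a<d zero    k = trans (count-Q-zero a k)
    (sym (cong₂ _+_ (count-Q-zero (suc a) k) (t·x·-zero (x^ ℓ′ · count (Q (suc a))) k)))
  count-Q-step a a<d (suc n) k = begin
    count (Q a) (suc n) k
      ≡⟨ count-Q-suc a n k ⟩
    count E n k + sum (λ b → afterTile (a ≤ᵇ toℕ b) b n k)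
      ≡⟨ cong (λ s → count E n k + s)
              (sum-threshold-peel a a<d (λ β b → afterTile β b n k) λ _ → t·count-∅ n k) ⟩
    count E n k + (afterTile true (fromℕ< a<d) n k + rest)
      ≡⟨ x∙yz≈xz∙y (count E n k) (afterTile true (fromℕ< a<d) n k) rest ⟩
    (count E n k + rest) + afterTile true (fromℕ< a<d) n k
      ≡⟨ cong₂ _+_ (count-Q-suc (suc a) n k) newTile ⟨
    count (Q (suc a)) (suc n) k + (t· x^ ℓ′ · count (Q (suc a))) n k
      ≡⟨ cong (λ s → count (Q (suc a)) (suc n) k + s) (t·x·-suc (x^ ℓ′ · count (Q (suc a))) n k) ⟨
    ([1+tx^ suc ℓ′ ]· count (Q (suc a))) (suc n) k ∎
    where
    open ≡-Reasoning
    rest : ℤ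
    rest = sum (λ b → afterTile (suc a ≤ᵇ toℕ b) b n k)
    newTile : (t· x^ ℓ′ · count (Q (suc a))) n k ≡ afterTile true (fromℕ< a<d) n k
    newTile = sym (trans (cong (λ c → (t· count (blanksThen ℓ′ (Q (suc c)))) n k) (Fin.toℕ-fromℕ< a<d))
                         (t·-cong (count-blanksThen ℓ′ (Q (suc a))) n k))

  count-Q-top : count (Q d) ≈ˢ x· count E
  count-Q-top zero    k = count-Q-zero d k
  count-Q-top (suc n) k = begin
    count (Q d) (suc n) k                                 ≡⟨ count-Q-suc d n k ⟩
    count E n k + sum (λ b → afterTile (d ≤ᵇ toℕ b) b n k) ≡⟨ cong (λ s → count E n k + s) noTile ⟩
    count E n k + 0ℤ                                      ≡⟨ ℤ.+-identityʳ (count E n k) ⟩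
    count E n k                                           ∎
    where
    open ≡-Reasoning
    noTile : sum (λ b → afterTile (d ≤ᵇ toℕ b) b n k) ≡ 0ℤ
    noTile = sum-zero _ λ b → trans
      (cong (λ β → afterTile β b n k)
            (Reflects.det (ℕ.≤ᵇ-reflects-≤ d (toℕ b)) (Reflects.of (ℕ.<⇒≱ (Fin.toℕ<n b)))))
      (t·count-∅ n k)

  count-Q-from : ∀ e a → e ℕ.+ a ≡ d → count (Q a) ≈ˢ x· count E ·[1+tx^ suc ℓ′ ]^ e
  count-Q-from zero    a refl  = count-Q-top
  count-Q-from (suc e) a e+a≡d = ≈ˢ-trans (count-Q-step a a<d)
    ([1+tx^]-cong (suc ℓ′) (count-Q-from e (suc a) (trans (ℕ.+-suc e a) e+a≡d)))
    where
    a<d : a < d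
    a<d = subst (a <_) e+a≡d (s≤s (ℕ.m≤n+m a e))

  count-Q₀ : count (Q 0) ≈ˢ x· count E ·[1+tx^ suc ℓ′ ]^ d
  count-Q₀ = count-Q-from d 0 (ℕ.+-identityʳ d)

-- Anchor words and fault-free words as boolean tests

just≢nothing : ∀ {A : Set} {x : A} → just x ≢ nothing
just≢nothing ()

module _ {d : ℕ} where

  -- Thresholds refer to the index toℕ b of the letter just b, which stands for the integer toℕ b + 1.
  letterAtLeast : ℕ → Letter d → Bool
  letterAtLeast a nothing  = true
  letterAtLeast a (just b) = a ≤ᵇ toℕ b

  headAtLeast : ℕ → WordPred {d}
  headAtLeast a []      = false
  headAtLeast a (x ∷ _) = letterAtLeast a x

  at : ∀ {n} → Word d n → ℕ → Letter d
  at []      _       = nothing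
  at (x ∷ w) zero    = x
  at (x ∷ w) (suc m) = at w m

  lookup-fromℕ< : ∀ {n} (w : Word d n) m (p : m < n) → lookup w (fromℕ< p) ≡ at w m
  lookup-fromℕ< (x ∷ w) zero    p = refl
  lookup-fromℕ< (x ∷ w) (suc m) p = lookup-fromℕ< w m (s≤s⁻¹ p)

  blanksThen-headAtLeast : ∀ r a {n} (w : Word d n) →
    Bool.T (blanksThen r (headAtLeast a) w) ⇔
    (r < n × (∀ j → j < r → at w j ≡ nothing) × Bool.T (letterAtLeast a (at w r)))
  blanksThen-headAtLeast zero    a []            = mk⇔ (λ ()) λ ()
  blanksThen-headAtLeast zero    a (x ∷ w)       = mk⇔ (λ hd → z<s , (λ _ ()) , hd) (proj₂ ∘ proj₂)
  blanksThen-headAtLeast (suc r) a []            = mk⇔ (λ ()) λ ()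
  blanksThen-headAtLeast (suc r) a (just b ∷ w)  =
    mk⇔ (λ ()) λ (_ , blank , _) → ⊥-elim (just≢nothing (blank zero z<s))
  blanksThen-headAtLeast (suc r) a (nothing ∷ w) = mk⇔
    (λ t → let r<n , blank , hd = Equivalence.to (blanksThen-headAtLeast r a w) t in
      s≤s r<n , (λ { zero _ → refl ; (suc j) j<r → blank j (s≤s⁻¹ j<r) }) , hd)
    (λ (r<n , blank , hd) → Equivalence.from (blanksThen-headAtLeast r a w)
      (s≤s⁻¹ r<n , (λ j j<r → blank (suc j) (s≤s j<r)) , hd))

module _ {ℓ d : ℕ} (μ : Fin (suc ℓ) → ℕ) where

  -- Positions past the end read as ∞ through at, so no bound on k is needed.
  TileFits : ∀ {n} → Fin d → Word d n → Set
  TileFits {n} b w = ℓ ≤ n × (∀ (k : Fin ℓ) → val (at w (toℕ k)) ≥∞ (suc (toℕ b) ℕ.+ μ (Fin.suc k)))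

  isAnchor-∷⁻ : ∀ {n} x (w : Word d n) → IsAnchorWord μ (x ∷ w) → IsAnchorWord μ w
  isAnchor-∷⁻ x w (fits , tail) =
    (λ i k a eq p → fits (Fin.suc i) k a eq (s≤s p)) , (λ i le → tail (Fin.suc i) (s≤s le))

  isAnchor-∷⁺ : ∀ {n} x (w : Word d n) → IsAnchorWord μ w → (∀ b → x ≡ just b → TileFits b w) →
                IsAnchorWord μ (x ∷ w)
  isAnchor-∷⁺ {n} x w (fits , tail) head =
    (λ { Fin.zero k b x≡b p → subst (λ y → val y ≥∞ _) (sym (lookup-fromℕ< w (toℕ k) (s≤s⁻¹ p)))
                                    (proj₂ (head b x≡b) k)
       ; (Fin.suc i) k b eq p → fits i k b eq (s≤s⁻¹ p) }) ,
    (λ { Fin.zero n<ℓ → blankNearEnd x head n<ℓ ; (Fin.suc i) le → tail i (s≤s⁻¹ le) })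
    where
    blankNearEnd : ∀ y → (∀ b → y ≡ just b → TileFits b w) → n < ℓ → y ≡ nothing
    blankNearEnd nothing  _    _   = refl
    blankNearEnd (just b) head n<ℓ = ⊥-elim (ℕ.<⇒≱ n<ℓ (proj₁ (head b refl)))

  isAnchor-∞∷ : ∀ {n} (w : Word d n) → IsAnchorWord μ (nothing ∷ w) ⇔ IsAnchorWord μ w
  isAnchor-∞∷ w = mk⇔ (isAnchor-∷⁻ nothing w) (λ anc → isAnchor-∷⁺ nothing w anc λ _ ())

  isAnchor-b∷ : ∀ {n} b (w : Word d n) → IsAnchorWord μ (just b ∷ w) ⇔ (IsAnchorWord μ w × TileFits b w)
  isAnchor-b∷ {n} b w = mk⇔
    (λ anc → isAnchor-∷⁻ (just b) w anc , tileFits anc)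
    (λ (anc , fits) → isAnchor-∷⁺ (just b) w anc λ { _ refl → fits })
    where
    tileFits : IsAnchorWord μ (just b ∷ w) → TileFits b w
    tileFits (fits , tail) = ℓ≤n , λ k → let p = ℕ.<-≤-trans (Fin.toℕ<n k) ℓ≤n in
      subst (λ y → val y ≥∞ _) (lookup-fromℕ< w (toℕ k) p) (fits Fin.zero k b refl (s≤s p))
      where
      ℓ≤n : ℓ ≤ n
      ℓ≤n = ℕ.≮⇒≥ (λ n<ℓ → just≢nothing (tail Fin.zero n<ℓ))

module _ {d : ℕ} (ℓ′ : ℕ) where

  anchor : WordPred {d}
  anchor []            = true
  anchor (nothing ∷ w) = anchor w
  anchor (just b ∷ w)  = blanksThen ℓ′ (headAtLeast (suc (toℕ b))) w ∧ anchor w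

  anchorFrom : ℕ → WordPred {d}
  anchorFrom a w = headAtLeast a w ∧ anchor w

  isEmpty : WordPred {d}
  isEmpty []      = true
  isEmpty (_ ∷ _) = false

  -- faultFreeFrom a accepts ∞ and the chains b₁ ∞^ℓ′ b₂ ⋯ b_m ∞^ℓ′ ∞ with a ≤ b₁ < ⋯ < b_m.
  faultFreeFrom : ℕ → WordPred {d}
  faultFreeAfter : ℕ → ℕ → WordPred {d}

  faultFreeFrom a []            = false
  faultFreeFrom a (nothing ∷ w) = isEmpty w
  faultFreeFrom a (just b ∷ w)  = (a ≤ᵇ toℕ b) ∧ faultFreeAfter ℓ′ (suc (toℕ b)) w

  faultFreeAfter zero    a w             = faultFreeFrom a w
  faultFreeAfter (suc r) a []            = false
  faultFreeAfter (suc r) a (nothing ∷ w) = faultFreeAfter r a w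
  faultFreeAfter (suc r) a (just _ ∷ w)  = false

  faultFreeAfter≡blanksThen : ∀ r a {n} (w : Word d n) → faultFreeAfter r a w ≡ blanksThen r (faultFreeFrom a) w
  faultFreeAfter≡blanksThen zero    a w             = refl
  faultFreeAfter≡blanksThen (suc r) a []            = refl
  faultFreeAfter≡blanksThen (suc r) a (nothing ∷ w) = faultFreeAfter≡blanksThen r a w
  faultFreeAfter≡blanksThen (suc r) a (just _ ∷ w)  = refl

  blanksThen-∧-anchor : ∀ r (P : WordPred) {n} (w : Word d n) →
                        (blanksThen r P w ∧ anchor w) ≡ blanksThen r (λ v → P v ∧ anchor v) w
  blanksThen-∧-anchor zero    P w             = refl
  blanksThen-∧-anchor (suc r) P []            = refl
  blanksThen-∧-anchor (suc r) P (nothing ∷ w) = blanksThen-∧-anchor r P w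
  blanksThen-∧-anchor (suc r) P (just _ ∷ w)  = refl

  count-isEmpty : count isEmpty ≈ˢ 1ˢ
  count-isEmpty zero    zero    = refl
  count-isEmpty zero    (suc k) = refl
  count-isEmpty (suc n) k       =
    trans (count-∷-cong isEmpty (λ _ → false) (λ _ _ → refl) n k) (count-∅ (suc n) k)

  count-faultFree : count (faultFreeFrom 0) ≈ˢ x· 1ˢ ·[1+tx^ suc ℓ′ ]^ d
  count-faultFree = ≈ˢ-trans ByFirstLetter.count-Q₀ (·[1+tx^]^-cong (suc ℓ′) d (x·-cong count-isEmpty))
    where
    module ByFirstLetter = FirstLetter ℓ′ isEmpty faultFreeFrom (λ _ → refl) (λ _ _ → refl)
      (λ a b w → cong ((a ≤ᵇ toℕ b) ∧_) (faultFreeAfter≡blanksThen ℓ′ (suc (toℕ b)) w))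

  count-anchor : count anchor ≈ˢ (1ˢ +ˢ x· count anchor ·[1+tx^ suc ℓ′ ]^ d)
  count-anchor = ≈ˢ-trans emptyOrNot (+ˢ-congˡ 1ˢ ByFirstLetter.count-Q₀)
    where
    module ByFirstLetter = FirstLetter ℓ′ anchor anchorFrom (λ _ → refl) (λ _ _ → refl)
      (λ a b w → cong ((a ≤ᵇ toℕ b) ∧_) (blanksThen-∧-anchor ℓ′ (headAtLeast (suc (toℕ b))) w))
    emptyOrNot : count anchor ≈ˢ (1ˢ +ˢ count (anchorFrom 0))
    emptyOrNot zero    zero    = refl
    emptyOrNot zero    (suc k) = refl
    emptyOrNot (suc n) k       = trans
      (count-∷-cong anchor (anchorFrom 0) (λ { nothing _ → refl ; (just _) _ → refl }) n k)
      (sym (ℤ.+-identityˡ (count (anchorFrom 0) (suc n) k)))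

module _ {d : ℕ} where

  AllBlank : ∀ {n} → ℕ → Word d n → Set
  AllBlank {n} r w = ∀ (j : Fin n) → toℕ j < r → lookup w j ≡ nothing

  allBlank-b∷ : ∀ {n r} b (w : Word d n) → ¬ AllBlank (suc r) (just b ∷ w)
  allBlank-b∷ b w blank = just≢nothing (blank Fin.zero z<s)

  allBlank-∞∷⁻ : ∀ {n r} (w : Word d n) → AllBlank (suc r) (nothing ∷ w) → AllBlank r w
  allBlank-∞∷⁻ w blank j j<r = blank (Fin.suc j) (s≤s j<r)

  allBlank-∞∷⁺ : ∀ {n r} (w : Word d n) → AllBlank r w → AllBlank (suc r) (nothing ∷ w)
  allBlank-∞∷⁺ w blank Fin.zero    _     = refl
  allBlank-∞∷⁺ w blank (Fin.suc j) j<1+r = blank j (s≤s⁻¹ j<1+r)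

  allBlank-mono : ∀ {n r s} (w : Word d n) → s ≤ r → AllBlank r w → AllBlank s w
  allBlank-mono w s≤r blank j j<s = blank j (ℕ.<-≤-trans j<s s≤r)

  NoInteriorBlock : ℕ → ∀ {n} → Word d n → Set
  NoInteriorBlock ℓ {n} w = ∀ (i : Fin n) → toℕ i ℕ.+ ℓ < n →
    ¬ (∀ (j : Fin n) → toℕ i ≤ toℕ j → toℕ j < toℕ i ℕ.+ ℓ → lookup w j ≡ nothing)

  noBlock-∷⁻ : ∀ {ℓ n} x (w : Word d n) → NoInteriorBlock ℓ (x ∷ w) → NoInteriorBlock ℓ w
  noBlock-∷⁻ x w noBlock i i+ℓ<n blank = noBlock (Fin.suc i) (s≤s i+ℓ<n)
    λ { Fin.zero () _ ; (Fin.suc j) i≤j j<i+ℓ → blank j (s≤s⁻¹ i≤j) (s≤s⁻¹ j<i+ℓ) }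

  noBlock-∷⁺ : ∀ {ℓ n} x (w : Word d n) → NoInteriorBlock ℓ w → (ℓ < suc n → ¬ AllBlank ℓ (x ∷ w)) →
               NoInteriorBlock ℓ (x ∷ w)
  noBlock-∷⁺ x w noBlock notFirst Fin.zero    ℓ<n     blank = notFirst ℓ<n λ j → blank j z≤n
  noBlock-∷⁺ x w noBlock notFirst (Fin.suc i) i+ℓ<1+n blank = noBlock i (s≤s⁻¹ i+ℓ<1+n)
    λ j i≤j j<i+ℓ → blank (Fin.suc j) (s≤s i≤j) (s≤s j<i+ℓ)

  noBlock-head : ∀ {ℓ n} (w : Word d n) → NoInteriorBlock ℓ w → ℓ < n → ¬ AllBlank ℓ w
  noBlock-head (x ∷ w) noBlock ℓ<n blank = noBlock Fin.zero ℓ<n λ j _ → blank j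

module _ {d : ℕ} (ℓ′ : ℕ) where

  private
    OneBlankRun : ℕ → ∀ {n} → Word d n → Set
    OneBlankRun r {n} w = ¬ (suc r < n × AllBlank (suc r) w)

  faultFreeAfter⇒ : ∀ r a {n} (w : Word d n) → r ≤ ℓ′ → Bool.T (faultFreeAfter ℓ′ r a w) →
    Bool.T (blanksThen r (headAtLeast a) w) × Bool.T (anchor ℓ′ w) × NoInteriorBlock (suc ℓ′) w × OneBlankRun r w
  faultFreeAfter⇒ zero    a []                  _ ()
  faultFreeAfter⇒ zero    a (nothing ∷ [])      _ _ =
    tt , tt , (λ { Fin.zero (s≤s ()) }) , λ (1<1 , _) → ℕ.n≮n 1 1<1
  faultFreeAfter⇒ zero    a (nothing ∷ (_ ∷ _)) _ ()
  faultFreeAfter⇒ zero    a (just c ∷ w)        _ ff =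
    let a≤c , ff′ = Equivalence.to T-∧ ff
        tile , anc , noBlock , _ = faultFreeAfter⇒ ℓ′ (suc (toℕ c)) w ℕ.≤-refl ff′
    in a≤c , Equivalence.from T-∧ (tile , anc) ,
       noBlock-∷⁺ (just c) w noBlock (λ _ → allBlank-b∷ c w) , λ (_ , blank) → allBlank-b∷ c w blank
  faultFreeAfter⇒ (suc r) a []                  _ ()
  faultFreeAfter⇒ (suc r) a (just _ ∷ w)        _ ()
  faultFreeAfter⇒ (suc r) a (nothing ∷ w)       r<ℓ′ ff =
    let tile , anc , noBlock , oneRun = faultFreeAfter⇒ r a w (ℕ.<⇒≤ r<ℓ′) ff
    in tile , anc ,
       noBlock-∷⁺ nothing w noBlock (λ ℓ<1+n blank → oneRun
         (ℕ.≤-<-trans r<ℓ′ (s≤s⁻¹ ℓ<1+n) , allBlank-mono w r<ℓ′ (allBlank-∞∷⁻ w blank))) ,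
       λ (r<n , blank) → oneRun (s≤s⁻¹ r<n , allBlank-∞∷⁻ w blank)

  faultFreeAfter⇐ : ∀ r a {n} (w : Word d n) →
    Bool.T (blanksThen r (headAtLeast a) w) → Bool.T (anchor ℓ′ w) →
    NoInteriorBlock (suc ℓ′) w → OneBlankRun r w → Bool.T (faultFreeAfter ℓ′ r a w)
  faultFreeAfter⇐ zero    a []                  ()
  faultFreeAfter⇐ zero    a (nothing ∷ [])      _ _ _ _      = tt
  faultFreeAfter⇐ zero    a (nothing ∷ (_ ∷ _)) _ _ _ oneRun =
    ⊥-elim (oneRun (s≤s (s≤s z≤n) , λ { Fin.zero _ → refl ; (Fin.suc _) (s≤s ()) }))
  faultFreeAfter⇐ zero    a (just c ∷ w)        a≤c anc noBlock _ =
    let tile , anc′ = Equivalence.to T-∧ anc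
        noBlock′ = noBlock-∷⁻ (just c) w noBlock
    in Equivalence.from T-∧ (a≤c , faultFreeAfter⇐ ℓ′ (suc (toℕ c)) w tile anc′ noBlock′
         λ (ℓ<n , blank) → noBlock-head w noBlock′ ℓ<n blank)
  faultFreeAfter⇐ (suc r) a []                  ()
  faultFreeAfter⇐ (suc r) a (just _ ∷ w)        ()
  faultFreeAfter⇐ (suc r) a (nothing ∷ w)       tile anc noBlock oneRun =
    faultFreeAfter⇐ r a w tile anc (noBlock-∷⁻ nothing w noBlock)
      λ (r<n , blank) → oneRun (s≤s r<n , allBlank-∞∷⁺ w blank)

-- Rigid tiles

monotone⇒inner-μ≥d : ∀ {ℓ′ d} (μ : Fin (suc (suc ℓ′)) → ℕ) →
  (∀ (i j : Fin (suc (suc ℓ′))) → i ≤ᶠ j → μ j ≤ μ i) →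
  (∀ (i : Fin (suc (suc ℓ′))) → suc (toℕ i) ≡ suc ℓ′ → d ≤ μ i) →
  ∀ (j : Fin ℓ′) → d ≤ μ (Fin.suc (Fin.inject₁ j))
monotone⇒inner-μ≥d {ℓ′} μ mono tileEnd j =
  ℕ.≤-trans (tileEnd last (cong suc toℕ-last)) (mono (Fin.suc (Fin.inject₁ j)) last j≤last)
  where
  last : Fin (suc (suc ℓ′))
  last = Fin.inject₁ (fromℕ ℓ′)
  toℕ-last : toℕ last ≡ ℓ′
  toℕ-last = trans (Fin.toℕ-inject₁ (fromℕ ℓ′)) (Fin.toℕ-fromℕ ℓ′)
  j≤last : Fin.suc (Fin.inject₁ j) ≤ᶠ last
  j≤last = subst₂ ℕ._<_ (sym (Fin.toℕ-inject₁ j)) (sym toℕ-last) (Fin.toℕ<n j)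

-- μ-inner is μ_k ≥ d for 1 ≤ k < ℓ, with k = j + 1.
module RigidTile {d ℓ′ : ℕ} (μ : Fin (suc (suc ℓ′)) → ℕ)
  (μ-inner : ∀ (j : Fin ℓ′) → d ≤ μ (Fin.suc (Fin.inject₁ j)))
  (μ-last  : μ (fromℕ (suc ℓ′)) ≡ 1)
  where

  beyond-alphabet⇒∞ : ∀ {m} (b : Fin d) (y : Letter d) → d ≤ m →
                      val y ≥∞ (suc (toℕ b) ℕ.+ m) → y ≡ nothing
  beyond-alphabet⇒∞     b nothing  _   _  = refl
  beyond-alphabet⇒∞ {m} b (just c) d≤m ge = ⊥-elim (ℕ.<⇒≱
    (ℕ.≤-trans (Fin.toℕ<n c) (ℕ.≤-trans d≤m (ℕ.m≤n+m m (toℕ b)))) (s≤s⁻¹ ge))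

  above-next⇔letterAtLeast : ∀ (b : Fin d) (y : Letter d) →
                             val y ≥∞ (suc (toℕ b) ℕ.+ 1) ⇔ Bool.T (letterAtLeast (suc (toℕ b)) y)
  above-next⇔letterAtLeast b nothing  = mk⇔ (λ _ → tt) (λ _ → tt)
  above-next⇔letterAtLeast b (just c) = mk⇔
    (λ ge → ℕ.≤⇒≤ᵇ (s≤s⁻¹ (subst (_≤ suc (toℕ c)) (ℕ.+-comm (suc (toℕ b)) 1) ge)))
    (λ t → subst (_≤ suc (toℕ c)) (ℕ.+-comm 1 (suc (toℕ b))) (s≤s (ℕ.≤ᵇ⇒≤ _ _ t)))

  tileFits⇔ : ∀ {n} (b : Fin d) (w : Word d n) →
              TileFits μ b w ⇔ Bool.T (blanksThen ℓ′ (headAtLeast (suc (toℕ b))) w)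
  tileFits⇔ {n} b w = FunEq.trans (mk⇔ to from) (FunEq.sym (blanksThen-headAtLeast ℓ′ (suc (toℕ b)) w))
    where
    Fits : ℕ → Fin (suc (suc ℓ′)) → Set
    Fits i k = val (at w i) ≥∞ (suc (toℕ b) ℕ.+ μ k)
    Blanks : Set
    Blanks = ℓ′ < n × (∀ j → j < ℓ′ → at w j ≡ nothing) ×
             Bool.T (letterAtLeast (suc (toℕ b)) (at w ℓ′))
    fitsLast : Fits (toℕ (fromℕ ℓ′)) (fromℕ (suc ℓ′)) ⇔ Bool.T (letterAtLeast (suc (toℕ b)) (at w ℓ′))
    fitsLast rewrite Fin.toℕ-fromℕ ℓ′ | μ-last = above-next⇔letterAtLeast b (at w ℓ′)
    to : TileFits μ b w → Blanks
    to (ℓ≤n , fits) = ℓ≤n , blank , Equivalence.to fitsLast (fits (fromℕ ℓ′))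
      where
      blank : ∀ j → j < ℓ′ → at w j ≡ nothing
      blank j j<ℓ′ = beyond-alphabet⇒∞ b (at w j) (μ-inner j′)
        (subst (λ i → Fits i (Fin.suc (Fin.inject₁ j′)))
               (trans (Fin.toℕ-inject₁ j′) (Fin.toℕ-fromℕ< j<ℓ′)) (fits (Fin.inject₁ j′)))
        where
        j′ : Fin ℓ′
        j′ = fromℕ< j<ℓ′
    from : Blanks → TileFits μ b w
    from (ℓ′<n , blank , last) = ℓ′<n , fit
      where
      fit : ∀ k → Fits (toℕ k) (Fin.suc k)
      fit k with Top.view k
      ... | Top.‵fromℕ     = Equivalence.from fitsLast last
      ... | Top.‵inject₁ j = subst (λ y → val y ≥∞ (suc (toℕ b) ℕ.+ μ (Fin.suc (Fin.inject₁ j))))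
        (sym (blank (toℕ (Fin.inject₁ j)) (subst (_< ℓ′) (sym (Fin.toℕ-inject₁ j)) (Fin.toℕ<n j)))) tt

  isAnchor⇔anchor : ∀ {n} (w : Word d n) → IsAnchorWord μ w ⇔ Bool.T (anchor ℓ′ w)
  isAnchor⇔anchor []            = mk⇔ (λ _ → tt) (λ _ → (λ ()) , (λ ()))
  isAnchor⇔anchor (nothing ∷ w) = FunEq.trans (isAnchor-∞∷ μ w) (isAnchor⇔anchor w)
  isAnchor⇔anchor (just b ∷ w)  = FunEq.trans (isAnchor-b∷ μ b w) (FunEq.trans
    (isAnchor⇔anchor w ×-⇔ tileFits⇔ b w) (FunEq.trans (mk⇔ swap swap) (FunEq.sym T-∧)))

  isFaultFree⇔faultFree : ∀ {n} (w : Word d n) → IsFaultFree μ w ⇔ Bool.T (faultFreeFrom ℓ′ 0 w)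
  isFaultFree⇔faultFree w = mk⇔ (to w) (from w)
    where
    to : ∀ {n} (w : Word d n) → IsFaultFree μ w → Bool.T (faultFreeFrom ℓ′ 0 w)
    to []       (inj₁ (() , _))
    to []       (inj₂ (_ , (() , _) , _))
    to (x ∷ []) (inj₁ (refl , allBlank)) rewrite allBlank Fin.zero = tt
    to (x ∷ w)  (inj₂ (anc , (Fin.zero , _ , b , x≡b) , noBlock)) =
      faultFreeAfter⇐ ℓ′ 0 0 (x ∷ w) (headAtLeast0 x) (Equivalence.to (isAnchor⇔anchor (x ∷ w)) anc) noBlock
        λ (_ , blank) → just≢nothing (trans (sym x≡b) (blank Fin.zero z<s))
      where
      headAtLeast0 : ∀ y → Bool.T (letterAtLeast 0 y)
      headAtLeast0 nothing  = tt
      headAtLeast0 (just _) = tt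
    to (x ∷ w)  (inj₂ (_ , (Fin.suc _ , () , _) , _))
    from : ∀ {n} (w : Word d n) → Bool.T (faultFreeFrom ℓ′ 0 w) → IsFaultFree μ w
    from []                  ()
    from (nothing ∷ [])      _  = inj₁ (refl , λ { Fin.zero → refl })
    from (nothing ∷ (_ ∷ _)) ()
    from (just b ∷ w)        ff =
      let _ , anc , noBlock , _ = faultFreeAfter⇒ ℓ′ 0 0 (just b ∷ w) z≤n ff
      in inj₂ (Equivalence.from (isAnchor⇔anchor (just b ∷ w)) anc , (Fin.zero , refl , b , refl) , noBlock)

  faultFree-counts≈G : ∀ (b : ℕ → ℕ → ℕ) →
    (∀ n k → HasCount (λ (w : Word d n) → IsFaultFree μ w × bigtiles w ≡ k) (b n k)) →
    fromℕˢ b ≈ˢ G (suc ℓ′) d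
  faultFree-counts≈G b counts = begin
    fromℕˢ b
      ≈⟨ (λ n k → HasCount⇒count (faultFreeFrom ℓ′ 0) isFaultFree⇔faultFree (counts n k)) ⟩
    count (faultFreeFrom ℓ′ 0)      ≈⟨ count-faultFree ℓ′ ⟩
    x· 1ˢ ·[1+tx^ suc ℓ′ ]^ d       ≈⟨ ≈ˢ-sym (G≈x·[1+tx^]^ (suc ℓ′) d) ⟩
    G (suc ℓ′) d                    ∎
    where open ≈ˢ-Reasoning

  anchor-counts*[1-G]≈1 : ∀ (c : ℕ → ℕ → ℕ) →
    (∀ n k → HasCount (λ (w : Word d n) → IsAnchorWord μ w × bigtiles w ≡ k) (c n k)) →
    (fromℕˢ c *ˢ (1ˢ -ˢ G (suc ℓ′) d)) ≈ˢ 1ˢ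
  anchor-counts*[1-G]≈1 c counts = f≈1+gf⇒f[1-g]≈1 (fromℕˢ c) (G (suc ℓ′) d) (begin
    fromℕˢ c                                   ≈⟨ c≈ ⟩
    count (anchor ℓ′)                          ≈⟨ count-anchor ℓ′ ⟩
    1ˢ +ˢ x· count (anchor ℓ′) ·[1+tx^ suc ℓ′ ]^ d
      ≈⟨ +ˢ-congˡ 1ˢ (·[1+tx^]^-cong (suc ℓ′) d (x·-cong (≈ˢ-sym c≈))) ⟩
    1ˢ +ˢ x· fromℕˢ c ·[1+tx^ suc ℓ′ ]^ d
      ≈⟨ +ˢ-congˡ 1ˢ (≈ˢ-sym (G-*ˢ (suc ℓ′) d (fromℕˢ c))) ⟩
    1ˢ +ˢ (G (suc ℓ′) d *ˢ fromℕˢ c)          ∎)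
    where
    open ≈ˢ-Reasoning
    c≈ : fromℕˢ c ≈ˢ count (anchor ℓ′)
    c≈ n k = HasCount⇒count (anchor ℓ′) isAnchor⇔anchor (counts n k)

proposition4p24 :
    (ℓ : ℕ) (μ : Fin (suc ℓ) → ℕ) (d : ℕ) →
    1 ≤ ℓ →
    (∀ (i j : Fin (suc ℓ)) → i ≤ᶠ j → μ j ≤ μ i) →
    1 ≤ d → d ≤ μ zero →
    μ (fromℕ ℓ) ≡ 1 →
    (∀ (i : Fin (suc ℓ)) → suc (toℕ i) ≡ ℓ → d ≤ μ i) →
    (∀ (b : ℕ → ℕ → ℕ) →
       (∀ n k → HasCount (λ (w : Word d n) → IsFaultFree μ w × bigtiles w ≡ k) (b n k)) →
       fromℕˢ b ≈ˢ G ℓ d)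
    ×
    (∀ (c : ℕ → ℕ → ℕ) →
       (∀ n k → HasCount (λ (w : Word d n) → IsAnchorWord μ w × bigtiles w ≡ k) (c n k)) →
       (fromℕˢ c *ˢ (1ˢ -ˢ G ℓ d)) ≈ˢ 1ˢ)
proposition4p24 zero     _ _ ()
proposition4p24 (suc ℓ′) μ d _ mono _ _ μ-last tileEnd = faultFree-counts≈G , anchor-counts*[1-G]≈1
  where open RigidTile μ (monotone⇒inner-μ≥d μ mono tileEnd) μ-last
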